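{- There is an absolute constant $\varepsilon>0$ such that for all sufficiently large $d$ and every small set $A$ with $A\subseteq\mathcal{E}$ or $A\subseteq\mathcal{O}$, we have $|A|\le(1-\varepsilon)|N(A)|$.
   Context: $Q_d$ is the Hamming cube on $V=\{0,1\}^d$ (adjacent iff differing in one coordinate); $\mathcal{E}$ (resp. $\mathcal{O}$) is the set of vertices with an even (resp. odd) number of ones. $N(A)$ is the set of vertices adjacent to some vertex of $A$. A fixed absolute constant $\alpha<2$ defines: $A$ is small if $|A|<\alpha^d$. -}

module Defs where

open import Data.Bool using (Bool; true; false; _∧_; _∨_; not; if_then_else_)
open import Data.Nat using (ℕ; zero; suc; _%_; _≡ᵇ_)
open import Data.Vec using (Vec; []; _∷_; zipWith; countᵇ)
open import Data.List using (List; []; _∷_; map; _++_; length)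
open import Data.Bool.ListAction using (any)
open import Data.Rational using (ℚ; 1ℚ; _*_)
open import Relation.Binary.PropositionalEquality using (_≡_)

Vertex : ℕ → Set
Vertex d = Vec Bool d

vertices : (d : ℕ) → List (Vertex d)
vertices zero = [] ∷ []
vertices (suc d) = map (false ∷_) (vertices d) ++ map (true ∷_) (vertices d)

VSet : ℕ → Set
VSet d = Vertex d → Bool

card : {d : ℕ} → VSet d → ℕ
card {d} A = length (Data.List.filterᵇ A (vertices d))
  where import Data.List

differ : Bool → Bool → Bool
differ true true = false
differ false false = false
differ _ _ = true

hamming : {d : ℕ} → Vertex d → Vertex d → ℕ
hamming u v = countᵇ (λ b → b) (zipWith differ u v)

adjacent : {d : ℕ} → Vertex d → Vertex d → Bool
adjacent u v = hamming u v ≡ᵇ 1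

N : {d : ℕ} → VSet d → VSet d
N {d} A v = any (λ u → A u ∧ adjacent u v) (vertices d)

weight : {d : ℕ} → Vertex d → ℕ
weight v = countᵇ (λ b → b) v

isEven : {d : ℕ} → Vertex d → Bool
isEven v = (weight v % 2) ≡ᵇ 0

⊆Even : {d : ℕ} → VSet d → Set
⊆Even A = ∀ v → A v ≡ true → isEven v ≡ true

⊆Odd : {d : ℕ} → VSet d → Set
⊆Odd A = ∀ v → A v ≡ true → isEven v ≡ false

_^ℚ_ : ℚ → ℕ → ℚ
q ^ℚ zero = 1ℚ
q ^ℚ suc n = q * (q ^ℚ n)

module Submission where

-- Let S = A ∪ N(A). A set inside one parity class is independent, so every vertex of A has all d of
-- its neighbours in N(A) and S carries at least 2d|A| ordered adjacent pairs. The edge-isoperimetric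
-- inequality of the cube, 2^(2e(S)) ≤ |S|^|S| (split along a coordinate and use
-- aᵃbᵇ4^min(a,b) ≤ (a+b)^(a+b)), therefore gives 4^(d|A|) ≤ |S|^|S|.
-- Write α = P/q with P < 2q, put K = 2q + 1 and ε = 1/(q+1). If (q+1)|A| > q|N(A)| then
-- q|S| < K|A|, and together with |A| < (P/q)^d this forces ((2q)^K)^d ≤ K^K (2P^K)^d.
-- By Bernoulli 2P^K < (2q)^K, so this fails as soon as d ≥ K^K · 2P^K.

open import Defs
open import Relation.Binary.PropositionalEquality

module Arithmetic where

  open import Data.Nat
  open import Data.Nat.Properties
  open import Data.Nat.Tactic.RingSolver using (solve-∀)
  open import Data.Sum using (inj₁; inj₂)
  open import Relation.Nullary using (contradiction; yes; no)

  ^-distribʳ-* : ∀ m n o → (m * n) ^ o ≡ m ^ o * n ^ o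
  ^-distribʳ-* m n zero    = refl
  ^-distribʳ-* m n (suc o) = begin
    m * n * (m * n) ^ o       ≡⟨ cong (m * n *_) (^-distribʳ-* m n o) ⟩
    m * n * (m ^ o * n ^ o)   ≡⟨ swap m n (m ^ o) (n ^ o) ⟩
    m * m ^ o * (n * n ^ o)   ∎
    where
    open ≡-Reasoning
    swap : ∀ a b c e → a * b * (c * e) ≡ a * c * (b * e)
    swap = solve-∀

  ^-*-comm : ∀ m n o → (m ^ n) ^ o ≡ (m ^ o) ^ n
  ^-*-comm m n o = begin
    (m ^ n) ^ o  ≡⟨ ^-*-assoc m n o ⟩
    m ^ (n * o)  ≡⟨ cong (m ^_) (*-comm n o) ⟩
    m ^ (o * n)  ≡⟨ ^-*-assoc m o n ⟨
    (m ^ o) ^ n  ∎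
    where open ≡-Reasoning

  ^-cancelʳ-≤ : ∀ n .{{_ : NonZero n}} {x y} → x ^ n ≤ y ^ n → x ≤ y
  ^-cancelʳ-≤ n {x} {y} xⁿ≤yⁿ with ≤-<-connex x y
  ... | inj₁ x≤y = x≤y
  ... | inj₂ y<x = contradiction xⁿ≤yⁿ (<⇒≱ (^-monoˡ-< n y<x))

  nⁿ≢0 : ∀ n → NonZero (n ^ n)
  nⁿ≢0 zero    = _
  nⁿ≢0 (suc n) = m^n≢0 (suc n) (suc n)

  -- (1 + 1/x)ⁿ ≥ 1 + n/x and (1 - 1/(x+1))ⁿ ≥ 1 - n/(x+1), cleared of denominators
  bernoulli⁺ : ∀ x n → x ^ n * (x + n) ≤ x * suc x ^ n
  bernoulli⁺ x zero = ≤-reflexive (base x)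
    where
    base : ∀ x → 1 * (x + 0) ≡ x * 1
    base = solve-∀
  bernoulli⁺ x (suc n) = begin
    x * x ^ n * (x + suc n)        ≡⟨ expand x (x ^ n) n ⟩
    x * (x ^ n * (x + n)) + x * x ^ n
      ≤⟨ +-mono-≤ (*-monoʳ-≤ x (bernoulli⁺ x n)) (*-monoʳ-≤ x (^-monoˡ-≤ n (n≤1+n x))) ⟩
    x * (x * suc x ^ n) + x * suc x ^ n ≡⟨ collect x (suc x ^ n) ⟩
    x * (suc x * suc x ^ n)        ∎
    where
    open ≤-Reasoning
    expand : ∀ x p n → x * p * (x + suc n) ≡ x * (p * (x + n)) + x * p
    expand = solve-∀
    collect : ∀ x p → x * (x * p) + x * p ≡ x * (suc x * p)
    collect = solve-∀

  bernoulli⁻ : ∀ x n → suc x ^ n * suc x ≤ x ^ n * suc x + n * suc x ^ n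
  bernoulli⁻ x zero = m≤m+n _ _
  bernoulli⁻ x (suc n) = begin
    suc x * suc x ^ n * suc x                     ≡⟨ *-assoc (suc x) (suc x ^ n) (suc x) ⟩
    suc x * (suc x ^ n * suc x)                   ≤⟨ *-monoʳ-≤ (suc x) (bernoulli⁻ x n) ⟩
    suc x * (x ^ n * suc x + n * suc x ^ n)       ≡⟨ expand x (x ^ n) (suc x ^ n) n ⟩
    x * x ^ n * suc x + x ^ n * suc x + n * (suc x * suc x ^ n)
      ≤⟨ +-monoˡ-≤ _ (+-monoʳ-≤ (x * x ^ n * suc x) (*-monoˡ-≤ (suc x) (^-monoˡ-≤ n (n≤1+n x)))) ⟩
    x * x ^ n * suc x + suc x ^ n * suc x + n * (suc x * suc x ^ n) ≡⟨ collect x (x ^ n) (suc x ^ n) n ⟩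
    x * x ^ n * suc x + suc n * (suc x * suc x ^ n) ∎
    where
    open ≤-Reasoning
    expand : ∀ x p r n → suc x * (p * suc x + n * r) ≡ x * p * suc x + p * suc x + n * (suc x * r)
    expand = solve-∀
    collect : ∀ x p r n → x * p * suc x + r * suc x + n * (suc x * r) ≡ x * p * suc x + suc n * (suc x * r)
    collect = solve-∀

  self-power-log-convex : ∀ n → suc n ^ suc n * suc n ^ suc n ≤ (2 + n) ^ (2 + n) * n ^ n
  self-power-log-convex n = begin
    suc n ^ suc n * suc n ^ suc n  ≡⟨ ^-distribʳ-* (suc n) (suc n) (suc n) ⟨
    (suc n * suc n) ^ suc n        ≡⟨ cong (_^ suc n) (square n) ⟩
    Q ^ suc n                      ≤⟨ *-cancelʳ-≤ _ _ Q (+-cancelʳ-≤ (n * R * Q ^ n) _ _ (begin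
      Q * Q ^ n * Q + n * R * Q ^ n    ≡⟨ factor (Q ^ n) Q n R ⟩
      Q ^ n * (Q * Q + n * R)          ≤⟨ *-monoʳ-≤ (Q ^ n) Q²+nR≤RQ ⟩
      Q ^ n * (R * Q)                  ≡⟨ rearrange (Q ^ n) R Q ⟩
      R * (Q ^ n * Q)                  ≤⟨ *-monoʳ-≤ R (bernoulli⁻ P n) ⟩
      R * (P ^ n * Q + n * Q ^ n)      ≡⟨ expand R (P ^ n) Q n (Q ^ n) ⟩
      R * P ^ n * Q + n * R * Q ^ n    ∎)) ⟩
    R * P ^ n                      ≡⟨ cong (R *_) (^-distribʳ-* (2 + n) n n) ⟩
    R * ((2 + n) ^ n * n ^ n)      ≡⟨ regroup (2 + n) ((2 + n) ^ n) (n ^ n) ⟩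
    (2 + n) ^ (2 + n) * n ^ n      ∎
    where
    open ≤-Reasoning
    P = (2 + n) * n
    Q = suc P
    R = (2 + n) * (2 + n)
    square : ∀ n → suc n * suc n ≡ suc ((2 + n) * n)
    square = solve-∀
    factor : ∀ x q n r → q * x * q + n * r * x ≡ x * (q * q + n * r)
    factor = solve-∀
    rearrange : ∀ x r q → x * (r * q) ≡ r * (x * q)
    rearrange = solve-∀
    expand : ∀ r y q n x → r * (y * q + n * x) ≡ r * y * q + n * r * x
    expand = solve-∀
    regroup : ∀ t x y → t * t * (x * y) ≡ t * (t * x) * y
    regroup = solve-∀
    slack : ∀ n → (2 + n) * (2 + n) * suc ((2 + n) * n)
                ≡ suc ((2 + n) * n) * suc ((2 + n) * n) + n * ((2 + n) * (2 + n)) + (n * n * n + 3 * (n * n) + 4 * n + 3)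
    slack = solve-∀
    Q²+nR≤RQ : Q * Q + n * R ≤ R * Q
    Q²+nR≤RQ = subst (Q * Q + n * R ≤_) (sym (slack n)) (m≤m+n _ _)

  self-power-ratio-mono : ∀ {k n} → k ≤′ n → suc k ^ suc k * n ^ n ≤ suc n ^ suc n * k ^ k
  self-power-ratio-mono ≤′-refl = ≤-refl
  self-power-ratio-mono {k} {suc n} (≤′-step k≤n) = *-cancelʳ-≤ _ _ (n ^ n) {{nⁿ≢0 n}} (begin
    suc k ^ suc k * suc n ^ suc n * n ^ n  ≡⟨ swap₂₃ (suc k ^ suc k) (suc n ^ suc n) (n ^ n) ⟩
    suc k ^ suc k * n ^ n * suc n ^ suc n  ≤⟨ *-monoˡ-≤ (suc n ^ suc n) (self-power-ratio-mono k≤n) ⟩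
    suc n ^ suc n * k ^ k * suc n ^ suc n  ≡⟨ gather (suc n ^ suc n) (k ^ k) ⟩
    k ^ k * (suc n ^ suc n * suc n ^ suc n) ≤⟨ *-monoʳ-≤ (k ^ k) (self-power-log-convex n) ⟩
    k ^ k * ((2 + n) ^ (2 + n) * n ^ n)    ≡⟨ rotate (k ^ k) ((2 + n) ^ (2 + n)) (n ^ n) ⟩
    (2 + n) ^ (2 + n) * k ^ k * n ^ n      ∎)
    where
    open ≤-Reasoning
    swap₂₃ : ∀ x y z → x * y * z ≡ x * z * y
    swap₂₃ = solve-∀
    gather : ∀ x y → x * y * x ≡ y * (x * x)
    gather = solve-∀
    rotate : ∀ x y z → x * (y * z) ≡ y * x * z
    rotate = solve-∀

  self-power-split : ∀ {a b} → a ≤′ b → a ^ a * b ^ b * 4 ^ a ≤ (a + b) ^ (a + b)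
  self-power-split {a} ≤′-refl = ≤-reflexive (begin-equality
    a ^ a * a ^ a * 4 ^ a      ≡⟨ cong (_* 4 ^ a) (^-distribʳ-* a a a) ⟨
    (a * a) ^ a * 4 ^ a        ≡⟨ ^-distribʳ-* (a * a) 4 a ⟨
    (a * a * 4) ^ a            ≡⟨ cong (_^ a) (double² a) ⟩
    ((a + a) * (a + a)) ^ a    ≡⟨ ^-distribʳ-* (a + a) (a + a) a ⟩
    (a + a) ^ a * (a + a) ^ a  ≡⟨ ^-distribˡ-+-* (a + a) a a ⟨
    (a + a) ^ (a + a)          ∎)
    where
    open ≤-Reasoning
    double² : ∀ a → a * a * 4 ≡ (a + a) * (a + a)
    double² = solve-∀
  self-power-split {a} {suc b} (≤′-step a≤b) = *-cancelʳ-≤ _ _ (b ^ b) {{nⁿ≢0 b}} (begin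
    a ^ a * suc b ^ suc b * 4 ^ a * b ^ b  ≡⟨ regroup (a ^ a) (suc b ^ suc b) (4 ^ a) (b ^ b) ⟩
    suc b ^ suc b * (a ^ a * b ^ b * 4 ^ a) ≤⟨ *-monoʳ-≤ (suc b ^ suc b) (self-power-split a≤b) ⟩
    suc b ^ suc b * (a + b) ^ (a + b)      ≤⟨ self-power-ratio-mono (≤⇒≤′ (m≤n+m b a)) ⟩
    suc (a + b) ^ suc (a + b) * b ^ b      ≡⟨ cong (λ m → m ^ m * b ^ b) (+-suc a b) ⟨
    (a + suc b) ^ (a + suc b) * b ^ b      ∎)
    where
    open ≤-Reasoning
    regroup : ∀ x y z w → x * y * z * w ≡ y * (x * w * z)
    regroup = solve-∀

  self-power-split-min : ∀ {a b m} → m ≤ a → m ≤ b → a ^ a * b ^ b * 4 ^ m ≤ (a + b) ^ (a + b)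
  self-power-split-min {a} {b} {m} m≤a m≤b with ≤-total a b
  ... | inj₁ a≤b = ≤-trans (*-monoʳ-≤ (a ^ a * b ^ b) (^-monoʳ-≤ 4 m≤a)) (self-power-split (≤⇒≤′ a≤b))
  ... | inj₂ b≤a = begin
    a ^ a * b ^ b * 4 ^ m  ≤⟨ *-monoʳ-≤ (a ^ a * b ^ b) (^-monoʳ-≤ 4 m≤b) ⟩
    a ^ a * b ^ b * 4 ^ b  ≡⟨ cong (_* 4 ^ b) (*-comm (a ^ a) (b ^ b)) ⟩
    b ^ b * a ^ a * 4 ^ b  ≤⟨ self-power-split (≤⇒≤′ b≤a) ⟩
    (b + a) ^ (b + a)      ≡⟨ cong (λ n → n ^ n) (+-comm b a) ⟩
    (a + b) ^ (a + b)      ∎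
    where open ≤-Reasoning

  -- (1 + 1/x)ᴷ > 2 for x = Q - 1 < K
  double-pow-< : ∀ {P Q K} .{{_ : NonZero P}} → P < Q → Q ≤ K → 2 * P ^ K < Q ^ K
  double-pow-< {P} {suc x} {K} (s≤s P≤x) x<K = begin-strict
    2 * P ^ K  ≤⟨ *-monoʳ-≤ 2 (^-monoˡ-≤ K P≤x) ⟩
    2 * x ^ K  <⟨ *-cancelˡ-< x (2 * x ^ K) (suc x ^ K) (begin-strict
      x * (2 * x ^ K)  ≡⟨ rearrange x (x ^ K) ⟩
      x ^ K * (x + x)  <⟨ *-monoʳ-< (x ^ K) {{m^n≢0 x K}} (+-monoʳ-< x x<K) ⟩
      x ^ K * (x + K)  ≤⟨ bernoulli⁺ x K ⟩
      x * suc x ^ K    ∎) ⟩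
    suc x ^ K  ∎
    where
    open ≤-Reasoning
    instance
      x≢0 : NonZero x
      x≢0 = >-nonZero (≤-trans (>-nonZero⁻¹ P) P≤x)
    rearrange : ∀ x y → x * (2 * y) ≡ y * (x + x)
    rearrange = solve-∀

  exp-beats-linear : ∀ {C Y X d} .{{_ : NonZero Y}} → Y < X → C * Y ≤ d → C * Y ^ d < X ^ d
  exp-beats-linear {C} {Y} {X} {d} Y<X CY≤d = begin-strict
    C * Y ^ d          <⟨ m<n+m (C * Y ^ d) (m^n>0 Y d) ⟩
    Y ^ d + C * Y ^ d  ≤⟨ *-cancelˡ-≤ Y (begin
      Y * (Y ^ d + C * Y ^ d) ≡⟨ rearrange Y (Y ^ d) C ⟩
      Y ^ d * (Y + C * Y)     ≤⟨ *-monoʳ-≤ (Y ^ d) (+-monoʳ-≤ Y CY≤d) ⟩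
      Y ^ d * (Y + d)         ≤⟨ bernoulli⁺ Y d ⟩
      Y * suc Y ^ d           ∎) ⟩
    suc Y ^ d          ≤⟨ ^-monoˡ-≤ d Y<X ⟩
    X ^ d              ∎
    where
    open ≤-Reasoning
    rearrange : ∀ y p c → y * (p + c * p) ≡ p * (y + c * y)
    rearrange = solve-∀

  pow-exponent-trade : ∀ {b a s q K} .{{_ : NonZero a}} .{{_ : NonZero s}} →
                       b ^ a ≤ s ^ s → s * q ≤ K * a → b ^ q ≤ s ^ K
  pow-exponent-trade {b} {a} {s} {q} {K} bᵃ≤sˢ sq≤Ka = ^-cancelʳ-≤ a (begin
    (b ^ q) ^ a  ≡⟨ ^-*-comm b q a ⟩
    (b ^ a) ^ q  ≤⟨ ^-monoˡ-≤ q bᵃ≤sˢ ⟩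
    (s ^ s) ^ q  ≡⟨ ^-*-assoc s s q ⟩
    s ^ (s * q)  ≤⟨ ^-monoʳ-≤ s sq≤Ka ⟩
    s ^ (K * a)  ≡⟨ ^-*-assoc s K a ⟨
    (s ^ K) ^ a  ∎)
    where open ≤-Reasoning

  pow-bound : ∀ {q P a s d} .{{_ : NonZero q}} → let K = suc (2 * q) in
              (4 ^ d) ^ q ≤ s ^ K → q * s ≤ K * a → a * q ^ d ≤ P ^ d →
              ((2 * q) ^ K) ^ d ≤ K ^ K * (2 * P ^ K) ^ d
  pow-bound {q} {P} {a} {s} {d} 4ᵈᵠ≤sᴷ qs≤Ka aqᵈ≤Pᵈ = begin
    ((2 * q) ^ K) ^ d                ≡⟨ cong (_^ d) (^-distribʳ-* 2 q K) ⟩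
    (2 ^ K * q ^ K) ^ d              ≡⟨ cong (λ t → (2 * t * q ^ K) ^ d) (^-*-assoc 2 2 q) ⟨
    (2 * 4 ^ q * q ^ K) ^ d          ≡⟨ cong (_^ d) (*-assoc 2 (4 ^ q) (q ^ K)) ⟩
    (2 * (4 ^ q * q ^ K)) ^ d        ≡⟨ ^-distribʳ-* 2 (4 ^ q * q ^ K) d ⟩
    2 ^ d * (4 ^ q * q ^ K) ^ d      ≡⟨ cong (2 ^ d *_) (^-distribʳ-* (4 ^ q) (q ^ K) d) ⟩
    2 ^ d * ((4 ^ q) ^ d * (q ^ K) ^ d)
      ≡⟨ cong₂ (λ x y → 2 ^ d * (x * y)) (^-*-comm 4 q d) (^-*-comm q K d) ⟩
    2 ^ d * ((4 ^ d) ^ q * (q ^ d) ^ K) ≤⟨ *-monoʳ-≤ (2 ^ d) (drop-qᴷ core) ⟩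
    2 ^ d * (K ^ K * (P ^ d) ^ K)    ≡⟨ cong (λ x → 2 ^ d * (K ^ K * x)) (^-*-comm P d K) ⟩
    2 ^ d * (K ^ K * (P ^ K) ^ d)    ≡⟨ rearrange (2 ^ d) (K ^ K) ((P ^ K) ^ d) ⟩
    K ^ K * (2 ^ d * (P ^ K) ^ d)    ≡⟨ cong (K ^ K *_) (^-distribʳ-* 2 (P ^ K) d) ⟨
    K ^ K * (2 * P ^ K) ^ d          ∎
    where
    open ≤-Reasoning
    K = suc (2 * q)
    rearrange : ∀ t c p → t * (c * p) ≡ c * (t * p)
    rearrange = solve-∀
    drop-qᴷ : ∀ {x y} → q ^ K * x ≤ y → x ≤ y
    drop-qᴷ = ≤-trans (m≤n*m _ (q ^ K) {{m^n≢0 q K}})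
    core : q ^ K * ((4 ^ d) ^ q * (q ^ d) ^ K) ≤ K ^ K * (P ^ d) ^ K
    core = begin
      q ^ K * ((4 ^ d) ^ q * (q ^ d) ^ K)  ≡⟨ *-assoc (q ^ K) _ _ ⟨
      q ^ K * (4 ^ d) ^ q * (q ^ d) ^ K    ≤⟨ *-monoˡ-≤ ((q ^ d) ^ K) (*-monoʳ-≤ (q ^ K) 4ᵈᵠ≤sᴷ) ⟩
      q ^ K * s ^ K * (q ^ d) ^ K          ≡⟨ cong (_* (q ^ d) ^ K) (^-distribʳ-* q s K) ⟨
      (q * s) ^ K * (q ^ d) ^ K            ≤⟨ *-monoˡ-≤ ((q ^ d) ^ K) (^-monoˡ-≤ K qs≤Ka) ⟩
      (K * a) ^ K * (q ^ d) ^ K            ≡⟨ cong (_* (q ^ d) ^ K) (^-distribʳ-* K a K) ⟩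
      K ^ K * a ^ K * (q ^ d) ^ K          ≡⟨ *-assoc (K ^ K) (a ^ K) ((q ^ d) ^ K) ⟩
      K ^ K * (a ^ K * (q ^ d) ^ K)        ≡⟨ cong (K ^ K *_) (^-distribʳ-* a (q ^ d) K) ⟨
      K ^ K * (a * q ^ d) ^ K              ≤⟨ *-monoʳ-≤ (K ^ K) (^-monoˡ-≤ K aqᵈ≤Pᵈ) ⟩
      K ^ K * (P ^ d) ^ K                  ∎

  counting-bound : ∀ {q P d a n s} .{{_ : NonZero q}} .{{_ : NonZero P}} → let K = suc (2 * q) in
                   P < 2 * q → K ^ K * (2 * P ^ K) ≤ d → a * q ^ d < P ^ d →
                   s ≤ a + n → a ≤ s → (4 ^ d) ^ a ≤ s ^ s → suc q * a ≤ q * n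
  counting-bound {q} {a = zero} {n} _ _ _ _ _ _ = subst (_≤ q * n) (sym (*-zeroʳ (suc q))) z≤n
  counting-bound {q} {P} {d} {a@(suc _)} {n} {s} P<2q d-large aqᵈ<Pᵈ s≤a+n a≤s bound
    with suc q * a ≤? q * n
  ... | yes expands = expands
  ... | no ¬expands = contradiction upper (<⇒≱ lower)
    where
    K = suc (2 * q)
    instance
      s≢0 : NonZero s
      s≢0 = >-nonZero (≤-trans (s≤s z≤n) a≤s)
      2Pᴷ≢0 : NonZero (2 * P ^ K)
      2Pᴷ≢0 = m*n≢0 2 (P ^ K) {{_}} {{m^n≢0 P K}}
    qs≤Ka : q * s ≤ K * a
    qs≤Ka = begin
      q * s              ≤⟨ *-monoʳ-≤ q s≤a+n ⟩
      q * (a + n)        ≡⟨ *-distribˡ-+ q a n ⟩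
      q * a + q * n      ≤⟨ +-monoʳ-≤ (q * a) (<⇒≤ (≰⇒> ¬expands)) ⟩
      q * a + suc q * a  ≡⟨ collect q a ⟩
      K * a              ∎
      where
      open ≤-Reasoning
      collect : ∀ q a → q * a + suc q * a ≡ suc (2 * q) * a
      collect = solve-∀
    upper : ((2 * q) ^ K) ^ d ≤ K ^ K * (2 * P ^ K) ^ d
    upper = pow-bound {q} {P} {a} {s} {d} 4ᵈᵠ≤sᴷ qs≤Ka (<⇒≤ aqᵈ<Pᵈ)
      where
      4ᵈᵠ≤sᴷ : (4 ^ d) ^ q ≤ s ^ K
      4ᵈᵠ≤sᴷ = pow-exponent-trade {4 ^ d} {a} {s} {q} {K} bound (subst (_≤ K * a) (*-comm q s) qs≤Ka)
    lower : K ^ K * (2 * P ^ K) ^ d < ((2 * q) ^ K) ^ d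
    lower = exp-beats-linear {K ^ K} {2 * P ^ K} {(2 * q) ^ K} {d} (double-pow-< P<2q (n≤1+n (2 * q))) d-large

module Hypercube where

  open import Data.Bool using (Bool; true; false; _∧_; _∨_; not)
  open import Data.Bool.Properties
    using (∧-zeroʳ; ∧-comm; ∧-identityʳ; ∧-conicalˡ; ∧-conicalʳ; ∨-zeroʳ; not-¬; not-involutive; T-≡)
  open import Data.Nat
  open import Data.Nat.Properties
  open import Data.Nat.Tactic.RingSolver using (solve-∀)
  open import Data.Nat.ListAction using (sum)
  open import Data.Nat.ListAction.Properties using (sum-++)
  open import Data.Vec using ([]; _∷_)
  open import Data.List using ([]; _∷_; _++_; map; length; filterᵇ)
  open import Data.List.Properties using (map-++; map-∘)
  open import Data.List.Membership.Propositional using (_∈_; lose)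
  open import Data.List.Membership.Propositional.Properties using (∈-++⁺ˡ; ∈-++⁺ʳ; ∈-map⁺)
  open import Data.List.Relation.Unary.Any using (here; satisfied)
  open import Data.List.Relation.Unary.Any.Properties using (any⁺; any⁻)
  open import Data.Product using (∃; _×_; _,_)
  open import Data.Sum using (_⊎_; inj₁; inj₂)
  open import Data.Empty using (⊥; ⊥-elim)
  open import Function using (_∘_; Equivalence)
  open import Relation.Nullary using (contradiction)
  open import Algebra.Properties.CommutativeSemigroup +-commutativeSemigroup using (interchange)
  open Arithmetic

  𝟙 : Bool → ℕ
  𝟙 true  = 1
  𝟙 false = 0

  cubeSum : (d : ℕ) → (Vertex d → ℕ) → ℕ
  cubeSum zero    f = f []
  cubeSum (suc d) f = cubeSum d (f ∘ (false ∷_)) + cubeSum d (f ∘ (true ∷_))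

  private variable d : ℕ

  OneParity : VSet d → Set
  OneParity A = ⊆Even A ⊎ ⊆Odd A

  cubeSum-cong : ∀ {f g : Vertex d → ℕ} → (∀ v → f v ≡ g v) → cubeSum d f ≡ cubeSum d g
  cubeSum-cong {zero}  f≗g = f≗g []
  cubeSum-cong {suc d} f≗g = cong₂ _+_ (cubeSum-cong (f≗g ∘ (false ∷_))) (cubeSum-cong (f≗g ∘ (true ∷_)))

  cubeSum-mono-≤ : ∀ {f g : Vertex d → ℕ} → (∀ v → f v ≤ g v) → cubeSum d f ≤ cubeSum d g
  cubeSum-mono-≤ {zero}  f≤g = f≤g []
  cubeSum-mono-≤ {suc d} f≤g =
    +-mono-≤ (cubeSum-mono-≤ (f≤g ∘ (false ∷_))) (cubeSum-mono-≤ (f≤g ∘ (true ∷_)))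

  cubeSum-zero : ∀ {f : Vertex d → ℕ} → (∀ v → f v ≡ 0) → cubeSum d f ≡ 0
  cubeSum-zero {zero}  f≗0 = f≗0 []
  cubeSum-zero {suc d} f≗0 = cong₂ _+_ (cubeSum-zero (f≗0 ∘ (false ∷_))) (cubeSum-zero (f≗0 ∘ (true ∷_)))

  cubeSum-distrib-+ : ∀ (f g : Vertex d → ℕ) → cubeSum d (λ v → f v + g v) ≡ cubeSum d f + cubeSum d g
  cubeSum-distrib-+ {zero}  f g = refl
  cubeSum-distrib-+ {suc d} f g = trans
    (cong₂ _+_ (cubeSum-distrib-+ (f ∘ (false ∷_)) (g ∘ (false ∷_)))
               (cubeSum-distrib-+ (f ∘ (true ∷_)) (g ∘ (true ∷_))))
    (interchange (cubeSum d (f ∘ (false ∷_))) (cubeSum d (g ∘ (false ∷_)))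
                 (cubeSum d (f ∘ (true ∷_))) (cubeSum d (g ∘ (true ∷_))))

  cubeSum-*ˡ : ∀ c (f : Vertex d → ℕ) → cubeSum d (λ v → c * f v) ≡ c * cubeSum d f
  cubeSum-*ˡ {zero}  c f = refl
  cubeSum-*ˡ {suc d} c f =
    trans (cong₂ _+_ (cubeSum-*ˡ c (f ∘ (false ∷_))) (cubeSum-*ˡ c (f ∘ (true ∷_)))) (sym (*-distribˡ-+ c _ _))

  cubeSum-comm : ∀ {e} (f : Vertex d → Vertex e → ℕ) →
                 cubeSum d (λ v → cubeSum e (f v)) ≡ cubeSum e (λ u → cubeSum d (λ v → f v u))
  cubeSum-comm {zero}  f = refl
  cubeSum-comm {suc d} f =
    trans (cong₂ _+_ (cubeSum-comm (f ∘ (false ∷_))) (cubeSum-comm (f ∘ (true ∷_))))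
          (sym (cubeSum-distrib-+ (λ u → cubeSum d (λ v → f (false ∷ v) u))
                                  (λ u → cubeSum d (λ v → f (true ∷ v) u))))

  ∈-vertices : (v : Vertex d) → v ∈ vertices d
  ∈-vertices []          = here refl
  ∈-vertices (false ∷ v) = ∈-++⁺ˡ (∈-map⁺ (false ∷_) (∈-vertices v))
  ∈-vertices (true ∷ v)  = ∈-++⁺ʳ _ (∈-map⁺ (true ∷_) (∈-vertices v))

  sum-map-vertices : ∀ (f : Vertex d → ℕ) → sum (map f (vertices d)) ≡ cubeSum d f
  sum-map-vertices {zero}  f = +-identityʳ (f [])
  sum-map-vertices {suc d} f = begin
    sum (map f (map (false ∷_) vs ++ map (true ∷_) vs))
      ≡⟨ cong sum (map-++ f (map (false ∷_) vs) _) ⟩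
    sum (map f (map (false ∷_) vs) ++ map f (map (true ∷_) vs))
      ≡⟨ sum-++ (map f (map (false ∷_) vs)) _ ⟩
    sum (map f (map (false ∷_) vs)) + sum (map f (map (true ∷_) vs))
      ≡⟨ cong₂ _+_ (cong sum (map-∘ vs)) (cong sum (map-∘ vs)) ⟨
    sum (map (f ∘ (false ∷_)) vs) + sum (map (f ∘ (true ∷_)) vs)
      ≡⟨ cong₂ _+_ (sum-map-vertices (f ∘ (false ∷_))) (sum-map-vertices (f ∘ (true ∷_))) ⟩
    cubeSum (suc d) f ∎
    where
    open ≡-Reasoning
    vs = vertices d

  length-filterᵇ : ∀ {A : Set} (p : A → Bool) xs → length (filterᵇ p xs) ≡ sum (map (𝟙 ∘ p) xs)
  length-filterᵇ p []       = refl
  length-filterᵇ p (x ∷ xs) with p x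
  ... | true  = cong suc (length-filterᵇ p xs)
  ... | false = length-filterᵇ p xs

  size : VSet d → ℕ
  size {d} S = cubeSum d (𝟙 ∘ S)

  card≡size : (S : VSet d) → card S ≡ size S
  card≡size {d} S = trans (length-filterᵇ S (vertices d)) (sum-map-vertices (𝟙 ∘ S))

  _==_ : Vertex d → Vertex d → Bool
  u == v = hamming u v ≡ᵇ 0

  ==-sound : (u v : Vertex d) → u == v ≡ true → u ≡ v
  ==-sound []          []          _  = refl
  ==-sound (false ∷ u) (false ∷ v) eq = cong (false ∷_) (==-sound u v eq)
  ==-sound (true ∷ u)  (true ∷ v)  eq = cong (true ∷_) (==-sound u v eq)

  ∧-[∧false] : ∀ x y → x ∧ (y ∧ false) ≡ false
  ∧-[∧false] x y = trans (cong (x ∧_) (∧-zeroʳ y)) (∧-zeroʳ x)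

  cubeSum-point : ∀ c (g : VSet d) v → cubeSum d (λ u → 𝟙 (c ∧ (g u ∧ u == v))) ≡ 𝟙 (c ∧ g v)
  cubeSum-point {zero}  c g []          = cong (λ x → 𝟙 (c ∧ x)) (∧-identityʳ (g []))
  cubeSum-point {suc d} c g (false ∷ v) = trans
    (cong₂ _+_ (cubeSum-point c (g ∘ (false ∷_)) v)
               (cubeSum-zero (λ u → cong 𝟙 (∧-[∧false] c (g (true ∷ u))))))
    (+-identityʳ _)
  cubeSum-point {suc d} c g (true ∷ v)  =
    cong₂ _+_ (cubeSum-zero (λ u → cong 𝟙 (∧-[∧false] c (g (false ∷ u))))) (cubeSum-point c (g ∘ (true ∷_)) v)

  hamming-sym : (u v : Vertex d) → hamming u v ≡ hamming v u
  hamming-sym []          []          = refl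
  hamming-sym (false ∷ u) (false ∷ v) = hamming-sym u v
  hamming-sym (true ∷ u)  (true ∷ v)  = hamming-sym u v
  hamming-sym (false ∷ u) (true ∷ v)  = cong suc (hamming-sym u v)
  hamming-sym (true ∷ u)  (false ∷ v) = cong suc (hamming-sym u v)

  adjacent-sym : (u v : Vertex d) → adjacent u v ≡ adjacent v u
  adjacent-sym u v = cong (_≡ᵇ 1) (hamming-sym u v)

  degree : (v : Vertex d) → cubeSum d (λ u → 𝟙 (adjacent u v)) ≡ d
  degree {zero}  []          = refl
  degree {suc d} (false ∷ v) = trans (cong₂ _+_ (degree v) (cubeSum-point true (λ _ → true) v)) (+-comm d 1)
  degree {suc d} (true ∷ v)  = cong₂ _+_ (cubeSum-point true (λ _ → true) v) (degree v)

  isEven-step : ∀ n → (suc n % 2 ≡ᵇ 0) ≡ not (n % 2 ≡ᵇ 0)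
  isEven-step zero          = refl
  isEven-step (suc zero)    = refl
  isEven-step (suc (suc n)) = isEven-step n

  isEven-true∷ : (v : Vertex d) → isEven (true ∷ v) ≡ not (isEven v)
  isEven-true∷ v = isEven-step (weight v)

  adjacent⇒parity-flip : (u v : Vertex d) → adjacent u v ≡ true → isEven u ≡ not (isEven v)
  adjacent⇒parity-flip []          []          ()
  adjacent⇒parity-flip (false ∷ u) (false ∷ v) adj = adjacent⇒parity-flip u v adj
  adjacent⇒parity-flip (true ∷ u)  (true ∷ v)  adj
    rewrite isEven-true∷ u | isEven-true∷ v = cong not (adjacent⇒parity-flip u v adj)
  adjacent⇒parity-flip (false ∷ u) (true ∷ v)  adj
    rewrite ==-sound u v adj | isEven-true∷ v = sym (not-involutive _)
  adjacent⇒parity-flip (true ∷ u)  (false ∷ v) adj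
    rewrite ==-sound u v adj = isEven-true∷ v

  N-intro : (A : VSet d) {u v : Vertex d} → A u ≡ true → adjacent u v ≡ true → N A v ≡ true
  N-intro A {u} Au adj =
    Equivalence.to T-≡ (any⁺ _ (lose (∈-vertices u) (Equivalence.from T-≡ (cong₂ _∧_ Au adj))))

  N-elim : (A : VSet d) {v : Vertex d} → N A v ≡ true → ∃ λ u → A u ≡ true × adjacent u v ≡ true
  N-elim {d} A NAv with satisfied (any⁻ _ (vertices d) (Equivalence.from T-≡ NAv))
  ... | u , T[Au∧adj] = u , ∧-conicalˡ _ _ Au∧adj , ∧-conicalʳ _ _ Au∧adj
    where Au∧adj = Equivalence.to T-≡ T[Au∧adj]

  same-parity : {A : VSet d} → OneParity A → ∀ {u v} → A u ≡ true → A v ≡ true → isEven u ≡ isEven v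
  same-parity (inj₁ even) Au Av = trans (even _ Au) (sym (even _ Av))
  same-parity (inj₂ odd)  Au Av = trans (odd _ Au) (sym (odd _ Av))

  N-disjoint : {A : VSet d} → OneParity A → ∀ {v} → N A v ≡ true → A v ≡ false
  N-disjoint {A = A} parity {v} NAv with N-elim A NAv | A v in Av
  ... | _ , _ , _    | false = refl
  ... | u , Au , adj | true  = ⊥-elim (not-¬ (same-parity parity Au Av) (adjacent⇒parity-flip u v adj))

  independent : {A : VSet d} → OneParity A → ∀ {u v} → A u ≡ true → adjacent u v ≡ true → A v ≡ false
  independent {A = A} parity Au adj = N-disjoint parity (N-intro A Au adj)

  -- Ordered pairs of adjacent vertices of S: twice the number of edges inside S.
  arcsIn : VSet d → ℕ
  arcsIn {d} S = cubeSum d (λ v → cubeSum d (λ u → 𝟙 (S v ∧ S u ∧ adjacent u v)))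

  arcsIn-split : (S : VSet (suc d)) → let m = size (λ v → S (false ∷ v) ∧ S (true ∷ v)) in
                 arcsIn S ≡ (arcsIn (S ∘ (false ∷_)) + m) + (m + arcsIn (S ∘ (true ∷_)))
  arcsIn-split {d} S = cong₂ _+_
    (trans (cubeSum-distrib-+ (arcsAt S₀) (λ v → cubeSum d (λ u → 𝟙 (S₀ v ∧ (S₁ u ∧ u == v)))))
           (cong (arcsIn S₀ +_) (cubeSum-cong (λ v → cubeSum-point (S₀ v) S₁ v))))
    (trans (cubeSum-distrib-+ (λ v → cubeSum d (λ u → 𝟙 (S₁ v ∧ (S₀ u ∧ u == v)))) (arcsAt S₁))
           (cong (_+ arcsIn S₁)
                 (cubeSum-cong (λ v → trans (cubeSum-point (S₁ v) S₀ v) (cong 𝟙 (∧-comm (S₁ v) (S₀ v)))))))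
    where
    S₀ S₁ : VSet d
    S₀ = S ∘ (false ∷_)
    S₁ = S ∘ (true ∷_)
    arcsAt : VSet d → Vertex d → ℕ
    arcsAt T v = cubeSum d (λ u → 𝟙 (T v ∧ T u ∧ adjacent u v))

  𝟙-∧-≤ˡ : ∀ x y → 𝟙 (x ∧ y) ≤ 𝟙 x
  𝟙-∧-≤ˡ true  true  = ≤-refl
  𝟙-∧-≤ˡ true  false = z≤n
  𝟙-∧-≤ˡ false _     = z≤n

  𝟙-∧-≤ʳ : ∀ x y → 𝟙 (x ∧ y) ≤ 𝟙 y
  𝟙-∧-≤ʳ true  _ = ≤-refl
  𝟙-∧-≤ʳ false _ = z≤n

  -- Induction on the dimension: the m arcs between the two halves are paid for by the factor 4ᵐ.
  edge-isoperimetry : (S : VSet d) → 2 ^ arcsIn S ≤ size S ^ size S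
  edge-isoperimetry {zero} S with S []
  ... | true  = ≤-refl
  ... | false = ≤-refl
  edge-isoperimetry {suc d} S = begin
    2 ^ arcsIn S                  ≡⟨ cong (2 ^_) (arcsIn-split S) ⟩
    2 ^ ((D₀ + m) + (m + D₁))     ≡⟨ cong (2 ^_) (regroup D₀ D₁ m) ⟩
    2 ^ (D₀ + D₁ + 2 * m)         ≡⟨ ^-distribˡ-+-* 2 (D₀ + D₁) (2 * m) ⟩
    2 ^ (D₀ + D₁) * 2 ^ (2 * m)   ≡⟨ cong₂ _*_ (^-distribˡ-+-* 2 D₀ D₁) (sym (^-*-assoc 2 2 m)) ⟩
    2 ^ D₀ * 2 ^ D₁ * 4 ^ m
      ≤⟨ *-monoˡ-≤ (4 ^ m) (*-mono-≤ (edge-isoperimetry S₀) (edge-isoperimetry S₁)) ⟩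
    a ^ a * b ^ b * 4 ^ m         ≤⟨ self-power-split-min (cubeSum-mono-≤ (λ v → 𝟙-∧-≤ˡ (S₀ v) (S₁ v)))
                                                           (cubeSum-mono-≤ (λ v → 𝟙-∧-≤ʳ (S₀ v) (S₁ v))) ⟩
    (a + b) ^ (a + b)             ∎
    where
    open ≤-Reasoning
    S₀ S₁ : VSet d
    S₀ = S ∘ (false ∷_)
    S₁ = S ∘ (true ∷_)
    D₀ = arcsIn S₀
    D₁ = arcsIn S₁
    m = size (λ v → S₀ v ∧ S₁ v)
    a = size S₀
    b = size S₁
    regroup : ∀ x y m → (x + m) + (m + y) ≡ x + y + 2 * m
    regroup = solve-∀

  𝟙-∧ : ∀ x y → 𝟙 (x ∧ y) ≡ 𝟙 x * 𝟙 y
  𝟙-∧ true  y = sym (+-identityʳ (𝟙 y))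
  𝟙-∧ false y = refl

  𝟙-∨-≤ : ∀ x y → 𝟙 (x ∨ y) ≤ 𝟙 x + 𝟙 y
  𝟙-∨-≤ true  y = s≤s z≤n
  𝟙-∨-≤ false y = ≤-refl

  𝟙-≤-∨ : ∀ x y → 𝟙 x ≤ 𝟙 (x ∨ y)
  𝟙-≤-∨ true  y = ≤-refl
  𝟙-≤-∨ false y = z≤n

  𝟙-disjoint-+ : ∀ {x y z} → (x ≡ true → z ≡ true) → (y ≡ true → z ≡ true) →
                 (x ≡ true → y ≡ true → ⊥) →
                 𝟙 x + 𝟙 y ≤ 𝟙 z
  𝟙-disjoint-+ {false} {false} _   _   _        = z≤n
  𝟙-disjoint-+ {true}  {false} x⇒z _   _        rewrite x⇒z refl = ≤-refl
  𝟙-disjoint-+ {false} {true}  _   y⇒z _        rewrite y⇒z refl = ≤-refl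
  𝟙-disjoint-+ {true}  {true}  _   _   disjoint = ⊥-elim (disjoint refl refl)

  arcs-from : (A : VSet d) → cubeSum d (λ v → cubeSum d (λ u → 𝟙 (A v ∧ adjacent u v))) ≡ d * size A
  arcs-from {d} A = trans (cubeSum-cong out-degree) (cubeSum-*ˡ d (𝟙 ∘ A))
    where
    open ≡-Reasoning
    out-degree : ∀ v → cubeSum d (λ u → 𝟙 (A v ∧ adjacent u v)) ≡ d * 𝟙 (A v)
    out-degree v = begin
      cubeSum d (λ u → 𝟙 (A v ∧ adjacent u v))      ≡⟨ cubeSum-cong (λ u → 𝟙-∧ (A v) (adjacent u v)) ⟩
      cubeSum d (λ u → 𝟙 (A v) * 𝟙 (adjacent u v))  ≡⟨ cubeSum-*ˡ (𝟙 (A v)) (λ u → 𝟙 (adjacent u v)) ⟩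
      𝟙 (A v) * cubeSum d (λ u → 𝟙 (adjacent u v))  ≡⟨ cong (𝟙 (A v) *_) (degree v) ⟩
      𝟙 (A v) * d                                   ≡⟨ *-comm (𝟙 (A v)) d ⟩
      d * 𝟙 (A v)                                   ∎

  arcs-into : (A : VSet d) → cubeSum d (λ v → cubeSum d (λ u → 𝟙 (A u ∧ adjacent u v))) ≡ d * size A
  arcs-into {d} A = begin
    cubeSum d (λ v → cubeSum d (λ u → 𝟙 (A u ∧ adjacent u v)))
      ≡⟨ cubeSum-comm (λ v u → 𝟙 (A u ∧ adjacent u v)) ⟩
    cubeSum d (λ u → cubeSum d (λ v → 𝟙 (A u ∧ adjacent u v)))
      ≡⟨ cubeSum-cong (λ u → cubeSum-cong (λ v → cong (λ b → 𝟙 (A u ∧ b)) (adjacent-sym u v))) ⟩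
    cubeSum d (λ u → cubeSum d (λ v → 𝟙 (A u ∧ adjacent v u)))
      ≡⟨ arcs-from A ⟩
    d * size A ∎
    where open ≡-Reasoning

  arcs-closed-neighbourhood : {A : VSet d} → OneParity A → 2 * (d * size A) ≤ arcsIn (λ v → A v ∨ N A v)
  arcs-closed-neighbourhood {d} {A} parity = begin
    2 * (d * size A)                   ≡⟨ cong₂ _+_ (arcs-from A) (cong (_+ 0) (arcs-into A)) ⟨
    cubeSum d out + (cubeSum d into + 0) ≡⟨ cong (cubeSum d out +_) (+-identityʳ (cubeSum d into)) ⟩
    cubeSum d out + cubeSum d into       ≡⟨ cubeSum-distrib-+ out into ⟨
    cubeSum d (λ v → out v + into v)
      ≡⟨ cubeSum-cong (λ v → cubeSum-distrib-+ (λ u → 𝟙 (A v ∧ adjacent u v))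
                                              (λ u → 𝟙 (A u ∧ adjacent u v))) ⟨
    cubeSum d (λ v → cubeSum d (λ u → 𝟙 (A v ∧ adjacent u v) + 𝟙 (A u ∧ adjacent u v)))
      ≤⟨ cubeSum-mono-≤ (λ v → cubeSum-mono-≤ (λ u → arc-in-S v u)) ⟩
    arcsIn S                           ∎
    where
    open ≤-Reasoning
    S : VSet d
    S v = A v ∨ N A v
    out into : Vertex d → ℕ
    out v = cubeSum d (λ u → 𝟙 (A v ∧ adjacent u v))
    into v = cubeSum d (λ u → 𝟙 (A u ∧ adjacent u v))
    A⊆S : ∀ {w} → A w ≡ true → S w ≡ true
    A⊆S {w} Aw = cong (_∨ N A w) Aw
    N⊆S : ∀ {w} → N A w ≡ true → S w ≡ true
    N⊆S {w} NAw = trans (cong (A w ∨_) NAw) (∨-zeroʳ (A w))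
    arc-in-S : ∀ v u → 𝟙 (A v ∧ adjacent u v) + 𝟙 (A u ∧ adjacent u v) ≤ 𝟙 (S v ∧ S u ∧ adjacent u v)
    arc-in-S v u = 𝟙-disjoint-+ out-arc in-arc not-both
      where
      out-arc : A v ∧ adjacent u v ≡ true → S v ∧ S u ∧ adjacent u v ≡ true
      out-arc Av∧adj = cong₂ _∧_ (A⊆S Av) (cong₂ _∧_ (N⊆S (N-intro A Av (trans (adjacent-sym v u) adj))) adj)
        where
        Av = ∧-conicalˡ _ _ Av∧adj
        adj = ∧-conicalʳ _ _ Av∧adj
      in-arc : A u ∧ adjacent u v ≡ true → S v ∧ S u ∧ adjacent u v ≡ true
      in-arc Au∧adj = cong₂ _∧_ (N⊆S (N-intro A Au adj)) (cong₂ _∧_ (A⊆S Au) adj)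
        where
        Au = ∧-conicalˡ _ _ Au∧adj
        adj = ∧-conicalʳ _ _ Au∧adj
      not-both : A v ∧ adjacent u v ≡ true → A u ∧ adjacent u v ≡ true → ⊥
      not-both Av∧adj Au∧adj = contradiction
        (trans (sym (∧-conicalˡ _ _ Av∧adj))
               (independent parity (∧-conicalˡ _ _ Au∧adj) (∧-conicalʳ _ _ Au∧adj)))
        λ ()

  size-∪-≤ : (X Y : VSet d) → size (λ v → X v ∨ Y v) ≤ size X + size Y
  size-∪-≤ X Y =
    ≤-trans (cubeSum-mono-≤ (λ v → 𝟙-∨-≤ (X v) (Y v))) (≤-reflexive (cubeSum-distrib-+ (𝟙 ∘ X) (𝟙 ∘ Y)))

  size-≤-∪ : (X Y : VSet d) → size X ≤ size (λ v → X v ∨ Y v)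
  size-≤-∪ X Y = cubeSum-mono-≤ (λ v → 𝟙-≤-∨ (X v) (Y v))

  neighbourhood-expansion : ∀ {q P d} .{{_ : NonZero q}} .{{_ : NonZero P}} → let K = suc (2 * q) in
                            P < 2 * q → K ^ K * (2 * P ^ K) ≤ d → (A : VSet d) → OneParity A →
                            card A * q ^ d < P ^ d → suc q * card A ≤ q * card (N A)
  neighbourhood-expansion {d = d} P<2q d-large A parity small rewrite card≡size A | card≡size (N A) =
    counting-bound P<2q d-large small (size-∪-≤ A (N A)) (size-≤-∪ A (N A)) isoperimetric
    where
    S : VSet d
    S v = A v ∨ N A v
    isoperimetric : (4 ^ d) ^ size A ≤ size S ^ size S
    isoperimetric = begin
      (4 ^ d) ^ size A        ≡⟨ ^-*-assoc 4 d (size A) ⟩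
      4 ^ (d * size A)        ≡⟨ ^-*-assoc 2 2 (d * size A) ⟩
      2 ^ (2 * (d * size A))  ≤⟨ ^-monoʳ-≤ 2 (arcs-closed-neighbourhood parity) ⟩
      2 ^ arcsIn S            ≤⟨ edge-isoperimetry S ⟩
      size S ^ size S         ∎
      where open ≤-Reasoning

open Hypercube using (neighbourhood-expansion)

open import Data.Nat as ℕ using (ℕ; zero; suc; _≥_)
import Data.Nat.Properties as ℕ
open import Data.Integer as ℤ using (+_; +[1+_]; -[1+_]; +0)
import Data.Integer.Properties as ℤ
open import Data.Product using (Σ; _×_; _,_)
open import Data.Sum using (_⊎_)
open import Data.Rational using (ℚ; mkℚ; 0ℚ; 1ℚ; _<_; _≤_; _-_; _*_; _/_; -_; toℚᵘ; fromℚᵘ; *<*)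
open import Data.Rational.Properties
  using (toℚᵘ-fromℚᵘ; toℚᵘ-homo-*; toℚᵘ-homo-+; toℚᵘ-homo‿-; toℚᵘ-mono-<; toℚᵘ-cancel-<;
         toℚᵘ-cancel-≤)
open import Data.Rational.Unnormalised as ℚᵘ using (mkℚᵘ; *≡*; *<*; *≤*)
  renaming (_≃_ to _≃ᵘ_; _<_ to _<ᵘ_; _≤_ to _≤ᵘ_; _*_ to _*ᵘ_)
import Data.Rational.Unnormalised.Properties as ℚᵘ
open import Data.Nat.Coprimality using (Coprime)

-- (r + 1) ^ d - 1, defined so that its successor is definitionally a product
pow-1 : ℕ → ℕ → ℕ
pow-1 r zero    = 0
pow-1 r (suc d) = pow-1 r d ℕ.+ r ℕ.* suc (pow-1 r d)

suc-pow-1 : ∀ r d → suc (pow-1 r d) ≡ suc r ℕ.^ d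
suc-pow-1 r zero    = refl
suc-pow-1 r (suc d) = cong (suc r ℕ.*_) (suc-pow-1 r d)

toℚᵘ-^ℚ : ∀ P r .(c : Coprime P (suc r)) d →
          toℚᵘ (mkℚ (+ P) r c ^ℚ d) ≃ᵘ mkℚᵘ (+ (P ℕ.^ d)) (pow-1 r d)
toℚᵘ-^ℚ P r c zero    = ℚᵘ.≃-refl
toℚᵘ-^ℚ P r c (suc d) = ℚᵘ.≃-trans (toℚᵘ-homo-* (mkℚ (+ P) r c) (mkℚ (+ P) r c ^ℚ d))
  (ℚᵘ.≃-trans (ℚᵘ.*-congˡ {mkℚᵘ (+ P) r} (toℚᵘ-^ℚ P r c d))
              (*≡* (cong (ℤ._* + suc (pow-1 r (suc d))) (sym (ℤ.pos-* P (P ℕ.^ d))))))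

toℚᵘ-ℕ : ∀ a → toℚᵘ ((+ a) / 1) ≃ᵘ mkℚᵘ (+ a) 0
toℚᵘ-ℕ a = toℚᵘ-fromℚᵘ (mkℚᵘ (+ a) 0)

ℕ<ᵘ⇒< : ∀ {a b r} → mkℚᵘ (+ a) 0 <ᵘ mkℚᵘ (+ b) r → a ℕ.* suc r ℕ.< b
ℕ<ᵘ⇒< {a} {b} {r} (*<* lt) with subst₂ ℤ._<_ (sym (ℤ.pos-* a (suc r))) (sym (ℤ.pos-* b 1)) lt
... | ℤ.+<+ a[1+r]<b = subst (a ℕ.* suc r ℕ.<_) (ℕ.*-identityʳ b) a[1+r]<b

<-^ℚ⇒ℕ : ∀ {a P r d} .{c : Coprime P (suc r)} →
         (+ a) / 1 < mkℚ (+ P) r c ^ℚ d → a ℕ.* suc r ℕ.^ d ℕ.< P ℕ.^ d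
<-^ℚ⇒ℕ {a} {P} {r} {d} {c} a<αᵈ = subst (λ x → a ℕ.* x ℕ.< P ℕ.^ d) (suc-pow-1 r d)
  (ℕ<ᵘ⇒< (ℚᵘ.<-respˡ-≃ (toℚᵘ-ℕ a) (ℚᵘ.<-respʳ-≃ (toℚᵘ-^ℚ P r c d) (toℚᵘ-mono-< a<αᵈ))))

-- 1/(q + 1): the denominator field of mkℚᵘ stores q
ε : ℕ → ℚ
ε q = fromℚᵘ (mkℚᵘ (+ 1) q)

ε>0 : ∀ q → 0ℚ < ε q
ε>0 q =
  toℚᵘ-cancel-< (ℚᵘ.<-respʳ-≃ (ℚᵘ.≃-sym (toℚᵘ-fromℚᵘ (mkℚᵘ (+ 1) q))) (*<* (ℤ.+<+ (ℕ.s≤s ℕ.z≤n))))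

toℚᵘ-1-ε : ∀ q → toℚᵘ (1ℚ - ε q) ≃ᵘ mkℚᵘ (+ q) q
toℚᵘ-1-ε q = ℚᵘ.≃-trans (toℚᵘ-homo-+ 1ℚ (- ε q))
  (ℚᵘ.≃-trans (ℚᵘ.+-congʳ (toℚᵘ 1ℚ)
                           (ℚᵘ.≃-trans (toℚᵘ-homo‿- (ε q)) (ℚᵘ.-‿cong (toℚᵘ-fromℚᵘ (mkℚᵘ (+ 1) q)))))
              (1-1/[1+q] q))
  where
  1-1/[1+q] : ∀ q → mkℚᵘ (+ 1) 0 ℚᵘ.+ ℚᵘ.- mkℚᵘ (+ 1) q ≃ᵘ mkℚᵘ (+ q) q
  1-1/[1+q] q rewrite ℕ.+-identityʳ q = *≡* refl

ℕ⇒≤-[1-ε]* : ∀ {q a n} → suc q ℕ.* a ℕ.≤ q ℕ.* n → (+ a) / 1 ≤ (1ℚ - ε q) * ((+ n) / 1)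
ℕ⇒≤-[1-ε]* {q} {a} {n} [1+q]a≤qn =
  toℚᵘ-cancel-≤ (ℚᵘ.≤-respˡ-≃ (ℚᵘ.≃-sym (toℚᵘ-ℕ a)) (ℚᵘ.≤-respʳ-≃ (ℚᵘ.≃-sym rhs) a≤qn/[1+q]))
  where
  rhs : toℚᵘ ((1ℚ - ε q) * ((+ n) / 1)) ≃ᵘ mkℚᵘ (+ q) q *ᵘ mkℚᵘ (+ n) 0
  rhs = ℚᵘ.≃-trans (toℚᵘ-homo-* (1ℚ - ε q) _) (ℚᵘ.*-cong (toℚᵘ-1-ε q) (toℚᵘ-ℕ n))
  a≤qn/[1+q] : mkℚᵘ (+ a) 0 ≤ᵘ mkℚᵘ (+ q) q *ᵘ mkℚᵘ (+ n) 0
  a≤qn/[1+q] = *≤* (subst₂ ℤ._≤_ (ℤ.pos-* a (suc q ℕ.* 1))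
                                 (trans (ℤ.pos-* (q ℕ.* n) 1) (cong (ℤ._* + 1) (ℤ.pos-* q n)))
    (ℤ.+≤+ (subst₂ ℕ._≤_ (trans (ℕ.*-comm (suc q) a) (cong (a ℕ.*_) (sym (ℕ.*-identityʳ (suc q)))))
                          (sym (ℕ.*-identityʳ (q ℕ.* n))) [1+q]a≤qn)))

lemma6p1 : (α : ℚ) → 0ℚ < α → α < (+ 2) / 1 →
    Σ ℚ λ ε → 0ℚ < ε × Σ ℕ λ d₀ → ∀ (d : ℕ) → d ≥ d₀ →
      (A : VSet d) → (⊆Even A ⊎ ⊆Odd A) →
      ((+ card A) / 1) < α ^ℚ d →
      ((+ card A) / 1) ≤ (1ℚ - ε) * ((+ card (N A)) / 1)
lemma6p1 (mkℚ +0       _ _) (*<* (ℤ.+<+ ())) _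
lemma6p1 (mkℚ -[1+ _ ] _ _) (*<* ()) _
lemma6p1 (mkℚ +[1+ p ] r _) _ (*<* (ℤ.+<+ P*1<2q)) =
  ε q , ε>0 q , K ℕ.^ K ℕ.* (2 ℕ.* P ℕ.^ K) , λ d d-large A parity small →
    ℕ⇒≤-[1-ε]* {q} {card A} {card (N A)}
      (neighbourhood-expansion {q} {P} P<2q d-large A parity (<-^ℚ⇒ℕ {card A} {d = d} small))
  where
  P = suc p
  q = suc r
  K = suc (2 ℕ.* q)
  P<2q : P ℕ.< 2 ℕ.* q
  P<2q = subst (ℕ._< 2 ℕ.* q) (ℕ.*-identityʳ P) P*1<2q
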